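{- Let $G$ be a connected graph with $n$ vertices, $k$ a positive integer, $\tau=\{1,\dots,k\}$, and $f:\tau\to\mathbb{Q}_{\ge1}$ a fitness function with $f(1)<f(2)<\dots<f(k)$. Let $M_0\in\Omega_0(G,\tau)$ and $M=M(G,\tau,f,M_0)$. Then for every $j\in\{2,\dots,k\}$, $$\mathbb{E}(A_{\ge j})\le\sum_{i=j}^k\frac{f(i)}{f(i)-f(i-1)}(n+1)n^3.$$
   Context: $\Omega_0(G,\tau)$ is the set of functions $V\to\tau$ whose range is all of $\tau$. For a state $S$, $S|_{v\to w}$ equals $S$ except that $w$ gets type $S(v)$. The Moran process $M(G,\tau,f,M_0)$ is the Markov chain on states started at $M_0$ in which, given $M_t$, a vertex $v$ is chosen with probability $f(M_t(v))/\sum_uf(M_t(u))$, then a uniformly random neighbour $w$ of $v$, and $M_{t+1}=M_t|_{v\to w}$. $V_i(t)=\{v:M_t(v)=i\}$. For $j\in\{2,\dots,k\}$, $A_{\ge j}=\min\{t\in\mathbb{Z}_{\ge0}: \bigcup_{i\ge j}V_i(t)=\emptyset\text{ or } V_i(t)=V\text{ for some } i\ge j\}$. -}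

module Defs where

open import Data.Nat as ℕ using (ℕ; zero; suc)
open import Data.Fin as Fin using (Fin; zero; suc; toℕ; inject₁)
open import Data.Fin.Properties using (_≟_)
open import Data.Bool using (Bool; true; false; if_then_else_; _∧_; _∨_; not)
open import Data.List using (List; []; _∷_; filter; length; map; foldr)
open import Data.Bool.ListAction using (all; any)
open import Data.List.Base using (allFin)
open import Data.Product using (Σ; _×_; _,_; ∃)
open import Data.Rational as ℚ using (ℚ; 0ℚ; 1ℚ; _+_; _*_; _-_; 1/_; ≢-nonZero)
open import Data.Rational.Properties as ℚP using ()
import Data.Integer as ℤ
open import Relation.Nullary using (yes; no; does)
open import Relation.Binary.PropositionalEquality using (_≡_)

record Graph (n : ℕ) : Set where
  field
    E     : Fin n → Fin n → Bool
    sym   : ∀ u v → E u v ≡ E v u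
    irref : ∀ v → E v v ≡ false
open Graph public

data Reach {n : ℕ} (G : Graph n) : Fin n → Fin n → Set where
  here : ∀ {v} → Reach G v v
  step : ∀ {u w v} → E G u w ≡ true → Reach G w v → Reach G u v

Connected : ∀ {n} → Graph n → Set
Connected G = ∀ u v → Reach G u v

neighbours : ∀ {n} → Graph n → Fin n → List (Fin n)
neighbours {n} G v = filter (λ w → E G v w ≟ᵇ true) (allFin n)
  where
  open import Data.Bool.Properties renaming (_≟_ to _≟ᵇ_)

deg : ∀ {n} → Graph n → Fin n → ℕ
deg G v = length (neighbours G v)

-- total division: p ÷ q, and 0 if q = 0 (only ever used with q ≠ 0)
_÷₀_ : ℚ → ℚ → ℚ
p ÷₀ q with q ℚP.≟ 0ℚ
... | yes _  = 0ℚ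
... | no q≢0 = p * (1/_ q {{≢-nonZero q≢0}})

ℕtoℚ : ℕ → ℚ
ℕtoℚ m = (ℤ.+ m) ℚ./ 1

sumℚ : List ℚ → ℚ
sumℚ = foldr _+_ 0ℚ

-- Types τ = {1,…,k} are represented as Fin k (type i+1 ↦ i : Fin k).
-- A state is a function V → τ.

State : ℕ → ℕ → Set
State n k = Fin n → Fin k

Ω₀ : (n k : ℕ) → State n k → Set
Ω₀ n k S = ∀ (i : Fin k) → ∃ λ (v : Fin n) → S v ≡ i

update : ∀ {n k} → State n k → Fin n → Fin n → State n k
update S v w u with u ≟ w
... | yes _ = S v
... | no  _ = S u

totalFitness : ∀ {n k} → (Fin k → ℚ) → State n k → ℚ
totalFitness {n} f S = sumℚ (map (λ u → f (S u)) (allFin n))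

-- probability that in state S vertex v is chosen and then neighbour w
-- of v is chosen:  f(S v)/Σ_u f(S u) · 1/deg(v)
stepProb : ∀ {n k} → Graph n → (Fin k → ℚ) → State n k → Fin n → Fin n → ℚ
stepProb G f S v w = (f (S v) ÷₀ totalFitness f S) * (1ℚ ÷₀ ℕtoℚ (deg G v))

-- The stopping condition of A_{≥j}:
--   ⋃_{i≥j} V_i(t) = ∅   or   V_i(t) = V for some i ≥ j.

_≤ᶠ_ : ∀ {k} → Fin k → Fin k → Bool
i ≤ᶠ i' = does (toℕ i ℕ.≤? toℕ i')

_=ᶠ_ : ∀ {m} → Fin m → Fin m → Bool
i =ᶠ i' = does (i ≟ i')

stopped : ∀ {n k} → Fin k → State n k → Bool
stopped {n} {k} j S =
  all (λ v → not (j ≤ᶠ S v)) (allFin n)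
  ∨ any (λ i → (j ≤ᶠ i) ∧ all (λ v → S v =ᶠ i) (allFin n)) (allFin k)

-- E[min(A_{≥j}, T)] for the Moran process M(G,τ,f,S) started at S.
expTrunc : ∀ {n k} → Graph n → (Fin k → ℚ) → Fin k → ℕ → State n k → ℚ
expTrunc G f j zero    S = 0ℚ
expTrunc {n} G f j (suc T) S =
  if stopped j S then 0ℚ
  else 1ℚ + sumℚ (map (λ v → sumℚ (map (λ w →
              stepProb G f S v w * expTrunc G f j T (update S v w))
            (neighbours G v))) (allFin n))

-- predecessor type i-1 (only used for i ≥ 2, i.e. index ≥ 1)
prevT : ∀ {k} → Fin k → Fin k
prevT {suc k} zero    = zero
prevT {suc k} (suc i) = inject₁ i

bound : ∀ {k} → (n : ℕ) → (Fin k → ℚ) → Fin k → ℚ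
bound {k} n f j =
  sumℚ (map (λ i → if j ≤ᶠ i
                   then (f i ÷₀ (f i - f (prevT i))) * ℕtoℚ ((suc n) ℕ.* (n ℕ.* n ℕ.* n))
                   else 0ℚ)
            (allFin k))

{-# OPTIONS --safe #-}
-- Weight a type t by ψ t = ∑ { c i ∣ j ≤ i, t < i } with c i = f i n³ / (f i - f (i - 1)), and a state S by
-- Φ S = ∑ᵤ ψ (S u) / deg u, so that Φ ≤ n ∑_{i ≥ j} c i, which is at most the bound. When w takes the type
-- of its neighbour v, Φ changes by (ψ (S v) - ψ (S w)) / deg w. Pairing the moves v → w and w → v, each
-- edge contributes (f (S v) - f (S w)) (ψ (S v) - ψ (S w)) / (W deg v deg w) to the expected change, where
-- W is the total fitness; this is ≤ 0 as f increases and ψ decreases. In an unstopped state connectivity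
-- gives an edge from a vertex of maximal type m ≥ j to one of smaller type, and its contribution is at most
-- -f m n³ / (W n²) ≤ -1 because W ≤ n f m. So Φ drops by 1 in expectation at every step before A_{≥j},
-- and induction on the truncation level gives E[min(A_{≥j}, T)] ≤ Φ M₀.
module Submission where

open import Defs hiding (sym)
open import Data.Nat using (ℕ; _≤_; _<_)
open import Data.Fin using (Fin; toℕ)
open import Data.Rational using (ℚ; 1ℚ) renaming (_≤_ to _≤ℚ_; _<_ to _<ℚ_)

open import Data.Nat using (zero; suc; z≤n; s≤s)
import Data.Nat as ℕ
import Data.Nat.Properties as ℕ
import Data.Nat.Coprimality as Coprime
import Data.Integer as ℤ
import Data.Integer.Properties as ℤ
open import Data.Fin using (zero; suc)
import Data.Fin.Properties as Fin
open import Data.Rational using (0ℚ; _+_; _*_; _-_; -_; mkℚ; 1/_; nonNegative; ≢-nonZero)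
import Data.Rational.Properties as ℚ
open import Data.Bool using (Bool; true; false; if_then_else_; _∧_; not)
import Data.Bool.Properties as Bool
open import Data.Bool.ListAction using (all; any)
open import Data.List using (List; []; _∷_; map; filter; length; allFin)
import Data.List.Properties as List
open import Data.List.Membership.Propositional using (_∈_)
open import Data.List.Membership.Propositional.Properties using (∈-allFin; ∈-filter⁺)
open import Data.List.Relation.Unary.Any using (here; there)
import Data.List.Relation.Unary.All as All
open import Data.List.Extrema.Nat using (argmax; f[xs]≤f[argmax])
open import Data.Product using (∃; ∃₂; _×_; _,_; proj₁; proj₂)
open import Data.Sum using (inj₁; inj₂)
open import Data.Empty using (⊥-elim)
open import Function using (id; flip; _∘_; case_of_)
open import Level using (0ℓ)
open import Data.Maybe using (Maybe; just; nothing)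
open import Relation.Binary.PropositionalEquality
open import Relation.Nullary using (yes; no; does; Dec; ¬_)
open import Relation.Nullary.Decidable using (dec-true; dec-false)
open import Tactic.RingSolver using (solve-∀)
open import Tactic.RingSolver.Core.AlmostCommutativeRing using (AlmostCommutativeRing; fromCommutativeRing)

private
  variable
    A B : Set
    n k : ℕ
    p q s : ℚ

-- Rational arithmetic

ℚ-ring : AlmostCommutativeRing 0ℓ 0ℓ
ℚ-ring = fromCommutativeRing ℚ.+-*-commutativeRing isZero
  where
  isZero : ∀ x → Maybe (0ℚ ≡ x)
  isZero x with 0ℚ ℚ.≟ x
  ... | yes 0≡x = just 0≡x
  ... | no _    = nothing

0≤1 : 0ℚ ≤ℚ 1ℚ
0≤1 = ℚ.<⇒≤ (ℚ.positive⁻¹ 1ℚ)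

*-nonNeg : 0ℚ ≤ℚ p → 0ℚ ≤ℚ q → 0ℚ ≤ℚ p * q
*-nonNeg {p} {q} 0≤p 0≤q = ℚ.nonNegative⁻¹ (p * q)
  {{ℚ.nonNeg*nonNeg⇒nonNeg p {{nonNegative 0≤p}} q {{nonNegative 0≤q}}}}

*-monoˡ-≤ : 0ℚ ≤ℚ s → p ≤ℚ q → s * p ≤ℚ s * q
*-monoˡ-≤ {s} 0≤s = ℚ.*-monoˡ-≤-nonNeg s {{nonNegative 0≤s}}

*-monoʳ-≤ : 0ℚ ≤ℚ s → p ≤ℚ q → p * s ≤ℚ q * s
*-monoʳ-≤ {s} 0≤s = ℚ.*-monoʳ-≤-nonNeg s {{nonNegative 0≤s}}

*-nonNeg-nonPos : 0ℚ ≤ℚ p → q ≤ℚ 0ℚ → p * q ≤ℚ 0ℚ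
*-nonNeg-nonPos {p} 0≤p q≤0 = ℚ.≤-trans (*-monoˡ-≤ 0≤p q≤0) (ℚ.≤-reflexive (ℚ.*-zeroʳ p))

*-nonPos-nonNeg : p ≤ℚ 0ℚ → 0ℚ ≤ℚ q → p * q ≤ℚ 0ℚ
*-nonPos-nonNeg {p} {q} p≤0 0≤q = ℚ.≤-trans (*-monoʳ-≤ 0≤q p≤0) (ℚ.≤-reflexive (ℚ.*-zeroˡ q))

p≤q⇒0≤q-p : p ≤ℚ q → 0ℚ ≤ℚ q - p
p≤q⇒0≤q-p {p} p≤q = ℚ.≤-trans (ℚ.≤-reflexive (sym (ℚ.+-inverseʳ p))) (ℚ.+-monoˡ-≤ (- p) p≤q)

p≤q⇒p-q≤0 : p ≤ℚ q → p - q ≤ℚ 0ℚ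
p≤q⇒p-q≤0 {q = q} p≤q = ℚ.≤-trans (ℚ.+-monoˡ-≤ (- q) p≤q) (ℚ.≤-reflexive (ℚ.+-inverseʳ q))

p+p≤q+q⇒p≤q : p + p ≤ℚ q + q → p ≤ℚ q
p+p≤q+q⇒p≤q {p} {q} p+p≤q+q = ℚ.≮⇒≥ λ q<p → ℚ.<-irrefl refl (ℚ.<-≤-trans (ℚ.+-mono-< q<p q<p) p+p≤q+q)

p<q⇒0<q-p : p <ℚ q → 0ℚ <ℚ q - p
p<q⇒0<q-p {p} p<q = ℚ.≤-<-trans (ℚ.≤-reflexive (sym (ℚ.+-inverseʳ p))) (ℚ.+-monoˡ-< (- p) p<q)

*-mono-≤-nonNeg : ∀ {p p′ q q′} → 0ℚ ≤ℚ p → 0ℚ ≤ℚ q → p ≤ℚ p′ → q ≤ℚ q′ → p * q ≤ℚ p′ * q′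
*-mono-≤-nonNeg 0≤p 0≤q p≤p′ q≤q′ = ℚ.≤-trans (*-monoʳ-≤ 0≤q p≤p′) (*-monoˡ-≤ (ℚ.≤-trans 0≤p p≤p′) q≤q′)

1≤p⇒1≤q⇒1≤p*q : 1ℚ ≤ℚ p → 1ℚ ≤ℚ q → 1ℚ ≤ℚ p * q
1≤p⇒1≤q⇒1≤p*q {p} {q} 1≤p 1≤q = begin
  1ℚ        ≤⟨ 1≤p ⟩
  p         ≡⟨ ℚ.*-identityʳ p ⟨
  p * 1ℚ    ≤⟨ *-monoˡ-≤ (ℚ.≤-trans 0≤1 1≤p) 1≤q ⟩
  p * q     ∎
  where open ℚ.≤-Reasoning

1÷₀-inverse : q ≢ 0ℚ → (1ℚ ÷₀ q) * q ≡ 1ℚ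
1÷₀-inverse {q} q≢0 with q ℚ.≟ 0ℚ
... | yes q≡0 = ⊥-elim (q≢0 q≡0)
... | no q≢0 = begin
  1ℚ * 1/ q * q    ≡⟨ ℚ.*-assoc 1ℚ (1/ q) q ⟩
  1ℚ * (1/ q * q)  ≡⟨ ℚ.*-identityˡ (1/ q * q) ⟩
  1/ q * q         ≡⟨ ℚ.*-inverseˡ q ⟩
  1ℚ               ∎
  where
  open ≡-Reasoning
  instance _ = ≢-nonZero q≢0

-- Since p ÷₀ 0 = 0, these two need no side condition on q.
÷₀≡*1÷₀ : ∀ p q → p ÷₀ q ≡ p * (1ℚ ÷₀ q)
÷₀≡*1÷₀ p q with q ℚ.≟ 0ℚ
... | yes _ = sym (ℚ.*-zeroʳ p)
... | no _  = cong (p *_) (sym (ℚ.*-identityˡ _))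

1÷₀-*-≤1 : ∀ q → (1ℚ ÷₀ q) * q ≤ℚ 1ℚ
1÷₀-*-≤1 q = case q ℚ.≟ 0ℚ of λ where
  (yes refl) → ℚ.≤-trans (ℚ.≤-reflexive (ℚ.*-zeroʳ (1ℚ ÷₀ 0ℚ))) 0≤1
  (no q≢0)   → ℚ.≤-reflexive (1÷₀-inverse q≢0)

1÷₀-nonNeg : 0ℚ ≤ℚ q → 0ℚ ≤ℚ 1ℚ ÷₀ q
1÷₀-nonNeg {q} 0≤q = case q ℚ.≟ 0ℚ of λ where
  (yes refl) → ℚ.≤-refl
  (no q≢0)   → ℚ.≮⇒≥ λ 1÷₀q<0 → ℚ.<-irrefl refl (ℚ.<-≤-trans (ℚ.positive⁻¹ 1ℚ)
                 (subst (_≤ℚ 0ℚ) (1÷₀-inverse q≢0) (*-nonPos-nonNeg (ℚ.<⇒≤ 1÷₀q<0) 0≤q)))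

÷₀-nonNeg : 0ℚ ≤ℚ p → 0ℚ ≤ℚ q → 0ℚ ≤ℚ p ÷₀ q
÷₀-nonNeg {p} {q} 0≤p 0≤q = subst (0ℚ ≤ℚ_) (sym (÷₀≡*1÷₀ p q)) (*-nonNeg 0≤p (1÷₀-nonNeg 0≤q))

ℕtoℚ≡mkℚ : ∀ m → ℕtoℚ m ≡ mkℚ (ℤ.+ m) 0 (Coprime.sym (Coprime.1-coprimeTo m))
ℕtoℚ≡mkℚ m = ℚ.normalize-coprime _

ℕtoℚ-suc : ∀ m → ℕtoℚ (suc m) ≡ 1ℚ + ℕtoℚ m
ℕtoℚ-suc m rewrite ℕtoℚ≡mkℚ m =
  -- the right side computes to (1 * 1 + m * 1) / 1
  sym (ℚ./-cong {p₁ = ℤ.+ 1 ℤ.* ℤ.+ 1 ℤ.+ ℤ.+ m ℤ.* ℤ.+ 1} {q₁ = 1}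
                (cong (ℤ._+_ (ℤ.+ 1)) (ℤ.*-identityʳ (ℤ.+ m))) refl)

ℕtoℚ-homo-+ : ∀ a b → ℕtoℚ (a ℕ.+ b) ≡ ℕtoℚ a + ℕtoℚ b
ℕtoℚ-homo-+ zero    b = sym (ℚ.+-identityˡ (ℕtoℚ b))
ℕtoℚ-homo-+ (suc a) b = begin
  ℕtoℚ (suc (a ℕ.+ b))         ≡⟨ ℕtoℚ-suc (a ℕ.+ b) ⟩
  1ℚ + ℕtoℚ (a ℕ.+ b)          ≡⟨ cong (1ℚ +_) (ℕtoℚ-homo-+ a b) ⟩
  1ℚ + (ℕtoℚ a + ℕtoℚ b)       ≡⟨ ℚ.+-assoc 1ℚ (ℕtoℚ a) (ℕtoℚ b) ⟨
  1ℚ + ℕtoℚ a + ℕtoℚ b         ≡⟨ cong (_+ ℕtoℚ b) (ℕtoℚ-suc a) ⟨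
  ℕtoℚ (suc a) + ℕtoℚ b        ∎
  where open ≡-Reasoning

ℕtoℚ-homo-* : ∀ a b → ℕtoℚ (a ℕ.* b) ≡ ℕtoℚ a * ℕtoℚ b
ℕtoℚ-homo-* zero    b = sym (ℚ.*-zeroˡ (ℕtoℚ b))
ℕtoℚ-homo-* (suc a) b = begin
  ℕtoℚ (b ℕ.+ a ℕ.* b)         ≡⟨ ℕtoℚ-homo-+ b (a ℕ.* b) ⟩
  ℕtoℚ b + ℕtoℚ (a ℕ.* b)      ≡⟨ cong (ℕtoℚ b +_) (ℕtoℚ-homo-* a b) ⟩
  ℕtoℚ b + ℕtoℚ a * ℕtoℚ b     ≡⟨ factor (ℕtoℚ a) (ℕtoℚ b) ⟩
  (1ℚ + ℕtoℚ a) * ℕtoℚ b       ≡⟨ cong (_* ℕtoℚ b) (ℕtoℚ-suc a) ⟨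
  ℕtoℚ (suc a) * ℕtoℚ b        ∎
  where
  open ≡-Reasoning
  factor : ∀ x y → y + x * y ≡ (1ℚ + x) * y
  factor = solve-∀ ℚ-ring

ℕtoℚ-nonNeg : ∀ a → 0ℚ ≤ℚ ℕtoℚ a
ℕtoℚ-nonNeg zero    = ℚ.≤-refl
ℕtoℚ-nonNeg (suc a) = ℚ.≤-trans (ℚ.+-mono-≤ 0≤1 (ℕtoℚ-nonNeg a)) (ℚ.≤-reflexive (sym (ℕtoℚ-suc a)))

ℕtoℚ-mono-≤ : ∀ {a b} → a ≤ b → ℕtoℚ a ≤ℚ ℕtoℚ b
ℕtoℚ-mono-≤ {a} a≤b with ℕ.m≤n⇒∃[o]m+o≡n a≤b
... | o , refl = begin
  ℕtoℚ a               ≡⟨ ℚ.+-identityʳ _ ⟨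
  ℕtoℚ a + 0ℚ          ≤⟨ ℚ.+-monoʳ-≤ (ℕtoℚ a) (ℕtoℚ-nonNeg o) ⟩
  ℕtoℚ a + ℕtoℚ o      ≡⟨ ℕtoℚ-homo-+ a o ⟨
  ℕtoℚ (a ℕ.+ o)       ∎
  where open ℚ.≤-Reasoning

1÷₀ℕ-≤1 : ∀ d → 1ℚ ÷₀ ℕtoℚ d ≤ℚ 1ℚ
1÷₀ℕ-≤1 zero    = 0≤1
1÷₀ℕ-≤1 (suc d) = begin
  1ℚ ÷₀ ℕtoℚ (suc d)                  ≡⟨ ℚ.*-identityʳ _ ⟨
  (1ℚ ÷₀ ℕtoℚ (suc d)) * 1ℚ           ≤⟨ *-monoˡ-≤ (1÷₀-nonNeg (ℕtoℚ-nonNeg (suc d))) (ℕtoℚ-mono-≤ {1} {suc d} (s≤s z≤n)) ⟩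
  (1ℚ ÷₀ ℕtoℚ (suc d)) * ℕtoℚ (suc d) ≤⟨ 1÷₀-*-≤1 (ℕtoℚ (suc d)) ⟩
  1ℚ                                  ∎
  where open ℚ.≤-Reasoning

-- Finite sums

∑ : List A → (A → ℚ) → ℚ
∑ xs g = sumℚ (map g xs)

syntax ∑ xs (λ x → e) = ∑[ x ∈ xs ] e

module _ {g h : A → ℚ} where

  ∑-cong : ∀ xs → (∀ x → g x ≡ h x) → ∑ xs g ≡ ∑ xs h
  ∑-cong []       _   = refl
  ∑-cong (x ∷ xs) g≡h = cong₂ _+_ (g≡h x) (∑-cong xs g≡h)

  ∑-mono-≤ : ∀ xs → (∀ x → g x ≤ℚ h x) → ∑ xs g ≤ℚ ∑ xs h
  ∑-mono-≤ []       _   = ℚ.≤-refl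
  ∑-mono-≤ (x ∷ xs) g≤h = ℚ.+-mono-≤ (g≤h x) (∑-mono-≤ xs g≤h)

  ∑-distrib-+ : ∀ xs → ∑[ x ∈ xs ] (g x + h x) ≡ ∑ xs g + ∑ xs h
  ∑-distrib-+ []       = sym (ℚ.+-identityˡ 0ℚ)
  ∑-distrib-+ (x ∷ xs) = trans (cong (g x + h x +_) (∑-distrib-+ xs)) (interchange (g x) (h x) (∑ xs g) (∑ xs h))
    where
    interchange : ∀ a b c d → (a + b) + (c + d) ≡ (a + c) + (b + d)
    interchange = solve-∀ ℚ-ring

∑-zero : ∀ (xs : List A) → ∑[ x ∈ xs ] 0ℚ ≡ 0ℚ
∑-zero []       = refl
∑-zero (x ∷ xs) = trans (ℚ.+-identityˡ _) (∑-zero xs)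

∑-nonNeg : ∀ (xs : List A) {g} → (∀ x → 0ℚ ≤ℚ g x) → 0ℚ ≤ℚ ∑ xs g
∑-nonNeg xs 0≤g = ℚ.≤-trans (ℚ.≤-reflexive (sym (∑-zero xs))) (∑-mono-≤ xs 0≤g)

∑-*ˡ : ∀ (xs : List A) c g → ∑[ x ∈ xs ] (c * g x) ≡ c * ∑ xs g
∑-*ˡ []       c g = sym (ℚ.*-zeroʳ c)
∑-*ˡ (x ∷ xs) c g = trans (cong (c * g x +_) (∑-*ˡ xs c g)) (sym (ℚ.*-distribˡ-+ c (g x) (∑ xs g)))

∑-neg : ∀ (xs : List A) g → ∑[ x ∈ xs ] (- g x) ≡ - ∑ xs g
∑-neg []       g = refl
∑-neg (x ∷ xs) g = trans (cong (- g x +_) (∑-neg xs g)) (sym (ℚ.neg-distrib-+ (g x) (∑ xs g)))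

∑-const : ∀ (xs : List A) c → ∑[ x ∈ xs ] c ≡ ℕtoℚ (length xs) * c
∑-const []       c = sym (ℚ.*-zeroˡ c)
∑-const (x ∷ xs) c = begin
  c + ∑[ x ∈ xs ] c                    ≡⟨ cong (c +_) (∑-const xs c) ⟩
  c + ℕtoℚ (length xs) * c             ≡⟨ factor (ℕtoℚ (length xs)) c ⟩
  (1ℚ + ℕtoℚ (length xs)) * c          ≡⟨ cong (_* c) (ℕtoℚ-suc (length xs)) ⟨
  ℕtoℚ (suc (length xs)) * c           ∎
  where
  open ≡-Reasoning
  factor : ∀ x y → y + x * y ≡ (1ℚ + x) * y
  factor = solve-∀ ℚ-ring

∑-allFin-const : ∀ n c → ∑[ x ∈ allFin n ] c ≡ ℕtoℚ n * c
∑-allFin-const n c = trans (∑-const (allFin n) c) (cong (λ l → ℕtoℚ l * c) (List.length-tabulate {n = n} id))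

∑-filter : ∀ {P : A → Set} (P? : ∀ x → Dec (P x)) xs g →
           ∑ (filter P? xs) g ≡ ∑[ x ∈ xs ] (if does (P? x) then g x else 0ℚ)
∑-filter P? []       g = refl
∑-filter P? (x ∷ xs) g with does (P? x)
... | true  = cong (g x +_) (∑-filter P? xs g)
... | false = trans (∑-filter P? xs g) (sym (ℚ.+-identityˡ _))

∑-comm : ∀ (xs : List A) (ys : List B) (F : A → B → ℚ) →
         ∑[ x ∈ xs ] ∑[ y ∈ ys ] F x y ≡ ∑[ y ∈ ys ] ∑[ x ∈ xs ] F x y
∑-comm []       ys F = sym (∑-zero ys)
∑-comm (x ∷ xs) ys F = trans (cong (∑ ys (F x) +_) (∑-comm xs ys F)) (sym (∑-distrib-+ {g = F x} ys))

∑-allFin-suc : ∀ n (g : Fin (suc n) → ℚ) → ∑ (allFin (suc n)) g ≡ g zero + ∑[ x ∈ allFin n ] g (suc x)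
∑-allFin-suc n g = cong (λ xs → g zero + sumℚ xs)
  (trans (List.map-tabulate suc g) (sym (List.map-tabulate id (λ x → g (suc x)))))

∑-allFin-δ : ∀ n (a : Fin n) c → ∑[ x ∈ allFin n ] (if x =ᶠ a then c else 0ℚ) ≡ c
∑-allFin-δ (suc n) zero    c = begin
  ∑[ x ∈ allFin (suc n) ] (if x =ᶠ zero then c else 0ℚ)  ≡⟨ ∑-allFin-suc n (λ x → if x =ᶠ zero then c else 0ℚ) ⟩
  c + ∑[ x ∈ allFin n ] 0ℚ                               ≡⟨ cong (c +_) (∑-zero (allFin n)) ⟩
  c + 0ℚ                                                 ≡⟨ ℚ.+-identityʳ c ⟩
  c                                                      ∎
  where open ≡-Reasoning
∑-allFin-δ (suc n) (suc a) c = begin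
  ∑ (allFin (suc n)) δ                               ≡⟨ ∑-allFin-suc n δ ⟩
  0ℚ + ∑[ x ∈ allFin n ] δ (suc x)                   ≡⟨ ℚ.+-identityˡ _ ⟩
  ∑[ x ∈ allFin n ] δ (suc x)                        ≡⟨ ∑-cong (allFin n) shift ⟩
  ∑[ x ∈ allFin n ] (if x =ᶠ a then c else 0ℚ)       ≡⟨ ∑-allFin-δ n a c ⟩
  c                                                  ∎
  where
  open ≡-Reasoning
  δ : Fin (suc n) → ℚ
  δ x = if x =ᶠ suc a then c else 0ℚ
  shift : ∀ x → δ (suc x) ≡ (if x =ᶠ a then c else 0ℚ)
  shift x with x Fin.≟ a
  ... | yes refl = refl
  ... | no  _    = refl

module _ {g : Fin n → ℚ} where

  ∑-nonNeg-≥-term : (∀ x → 0ℚ ≤ℚ g x) → ∀ a → g a ≤ℚ ∑ (allFin n) g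
  ∑-nonNeg-≥-term 0≤g a = ℚ.≤-trans (ℚ.≤-reflexive (sym (∑-allFin-δ n a (g a)))) (∑-mono-≤ (allFin n) below)
    where
    below : ∀ x → (if x =ᶠ a then g a else 0ℚ) ≤ℚ g x
    below x with x Fin.≟ a
    ... | yes refl = ℚ.≤-refl
    ... | no  _    = 0≤g x

  ∑-nonPos-≤-term : (∀ x → g x ≤ℚ 0ℚ) → ∀ a → ∑ (allFin n) g ≤ℚ g a
  ∑-nonPos-≤-term g≤0 a = ℚ.≤-trans (∑-mono-≤ (allFin n) above) (ℚ.≤-reflexive (∑-allFin-δ n a (g a)))
    where
    above : ∀ x → g x ≤ℚ (if x =ᶠ a then g a else 0ℚ)
    above x with x Fin.≟ a
    ... | yes refl = ℚ.≤-refl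
    ... | no  _    = g≤0 x

  ∑-nonPos-≤-two-terms : (∀ x → g x ≤ℚ 0ℚ) → ∀ {a b} → a ≢ b → ∑ (allFin n) g ≤ℚ g a + g b
  ∑-nonPos-≤-two-terms g≤0 {a} {b} a≢b = begin
    ∑ (allFin n) g                            ≤⟨ ∑-mono-≤ (allFin n) above ⟩
    ∑[ x ∈ allFin n ] (δ a x + δ b x)         ≡⟨ ∑-distrib-+ (allFin n) ⟩
    ∑ (allFin n) (δ a) + ∑ (allFin n) (δ b)   ≡⟨ cong₂ _+_ (∑-allFin-δ n a (g a)) (∑-allFin-δ n b (g b)) ⟩
    g a + g b                                 ∎
    where
    open ℚ.≤-Reasoning
    δ : Fin n → Fin n → ℚ
    δ y x = if x =ᶠ y then g y else 0ℚ
    above : ∀ x → g x ≤ℚ δ a x + δ b x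
    above x with x Fin.≟ a | x Fin.≟ b
    ... | yes refl | yes refl = ⊥-elim (a≢b refl)
    ... | yes refl | no  _    = ℚ.≤-reflexive (sym (ℚ.+-identityʳ (g x)))
    ... | no  _    | yes refl = ℚ.≤-reflexive (sym (ℚ.+-identityˡ (g x)))
    ... | no  _    | no  _    = ℚ.≤-trans (g≤0 x) (ℚ.≤-reflexive (sym (ℚ.+-identityˡ 0ℚ)))

does≡true⇒ : ∀ {P : Set} (P? : Dec P) → does P? ≡ true → P
does≡true⇒ (yes p) _ = p

does≡false⇒¬ : ∀ {P : Set} (P? : Dec P) → does P? ≡ false → ¬ P
does≡false⇒¬ (no ¬p) _ = ¬p

module _ {i i′ : Fin k} where

  ≤ᶠ⇒≤ : (i ≤ᶠ i′) ≡ true → toℕ i ≤ toℕ i′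
  ≤ᶠ⇒≤ = does≡true⇒ (toℕ i ℕ.≤? toℕ i′)

  ≤ᶠ≡false⇒> : (i ≤ᶠ i′) ≡ false → toℕ i′ < toℕ i
  ≤ᶠ≡false⇒> i≰i′ = ℕ.≰⇒> (does≡false⇒¬ (toℕ i ℕ.≤? toℕ i′) i≰i′)

  ≤⇒≤ᶠ : toℕ i ≤ toℕ i′ → (i ≤ᶠ i′) ≡ true
  ≤⇒≤ᶠ = dec-true (toℕ i ℕ.≤? toℕ i′)

  >⇒≤ᶠ≡false : toℕ i′ < toℕ i → (i ≤ᶠ i′) ≡ false
  >⇒≤ᶠ≡false i′<i = dec-false (toℕ i ℕ.≤? toℕ i′) (ℕ.<⇒≱ i′<i)

  =ᶠ≡false⇒≢ : (i =ᶠ i′) ≡ false → i ≢ i′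
  =ᶠ≡false⇒≢ = does≡false⇒¬ (i Fin.≟ i′)

toℕ-prevT : ∀ (i : Fin k) → toℕ (prevT i) ≡ ℕ.pred (toℕ i)
toℕ-prevT {suc k} zero    = refl
toℕ-prevT {suc k} (suc i) = Fin.toℕ-inject₁ i

all≡false⇒∃ : ∀ (p : A → Bool) xs → all p xs ≡ false → ∃ λ x → p x ≡ false
all≡false⇒∃ p (x ∷ xs) all≡false with p x in px
... | false = x , px
... | true  = all≡false⇒∃ p xs all≡false

any≡false⇒ : ∀ (p : A → Bool) {xs x} → any p xs ≡ false → x ∈ xs → p x ≡ false
any≡false⇒ p {y ∷ _} any≡false (here refl) = Bool.∨-conicalˡ (p y) _ any≡false
any≡false⇒ p {y ∷ _} any≡false (there x∈xs) = any≡false⇒ p (Bool.∨-conicalʳ (p y) _ any≡false) x∈xs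

-- Graphs

module _ (G : Graph n) where

  E⇒≢ : ∀ {u w} → E G u w ≡ true → u ≢ w
  E⇒≢ {u} Euw refl = case trans (sym (Graph.irref G u)) Euw of λ ()

  Reach⇒crossingEdge : ∀ (P : Fin n → Bool) {a b} → Reach G a b → P a ≡ true → P b ≡ false →
                       ∃₂ λ u w → E G u w ≡ true × P u ≡ true × P w ≡ false
  Reach⇒crossingEdge P here                  Pa Pb = case trans (sym Pa) Pb of λ ()
  Reach⇒crossingEdge P (step {u} {w} Euw walk) Pu Pb with P w in Pw
  ... | false = u , w , Euw , Pu , Pw
  ... | true  = Reach⇒crossingEdge P walk Pw Pb

  deg≤n : ∀ v → deg G v ≤ n
  deg≤n v = ℕ.≤-trans (List.length-filter _ (allFin n)) (ℕ.≤-reflexive (List.length-tabulate id))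

  E⇒deg>0 : ∀ {v w} → E G v w ≡ true → 0 < deg G v
  E⇒deg>0 {v} {w} Evw = nonEmpty (∈-filter⁺ (λ x → E G v x Bool.≟ true) (∈-allFin w) Evw)
    where
    nonEmpty : ∀ {xs : List (Fin n)} → w ∈ xs → 0 < length xs
    nonEmpty (here _)  = s≤s z≤n
    nonEmpty (there _) = s≤s z≤n

  invDeg : Fin n → ℚ
  invDeg v = 1ℚ ÷₀ ℕtoℚ (deg G v)

  invDeg-nonNeg : ∀ v → 0ℚ ≤ℚ invDeg v
  invDeg-nonNeg v = 1÷₀-nonNeg (ℕtoℚ-nonNeg (deg G v))

  invDeg≤1 : ∀ v → invDeg v ≤ℚ 1ℚ
  invDeg≤1 v = 1÷₀ℕ-≤1 (deg G v)

  1≤n*invDeg : ∀ {v} → 0 < deg G v → 1ℚ ≤ℚ ℕtoℚ n * invDeg v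
  1≤n*invDeg {v} deg>0 = begin
    1ℚ                            ≡⟨ 1÷₀-inverse deg≢0 ⟨
    invDeg v * ℕtoℚ (deg G v)     ≤⟨ *-monoˡ-≤ (invDeg-nonNeg v) (ℕtoℚ-mono-≤ (deg≤n v)) ⟩
    invDeg v * ℕtoℚ n             ≡⟨ ℚ.*-comm (invDeg v) (ℕtoℚ n) ⟩
    ℕtoℚ n * invDeg v             ∎
    where
    open ℚ.≤-Reasoning
    deg≢0 : ℕtoℚ (deg G v) ≢ 0ℚ
    deg≢0 deg≡0 = ℚ.<⇒≢ (ℚ.<-≤-trans (ℚ.positive⁻¹ 1ℚ) (ℕtoℚ-mono-≤ {1} deg>0)) (sym deg≡0)

  ∑ᴱ : (Fin n → Fin n → ℚ) → ℚ
  ∑ᴱ h = ∑[ v ∈ allFin n ] ∑[ w ∈ neighbours G v ] h v w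

  ∑-neighbours : ∀ v (h : Fin n → ℚ) →
                 ∑ (neighbours G v) h ≡ ∑[ w ∈ allFin n ] (if E G v w then h w else 0ℚ)
  ∑-neighbours v h = trans (∑-filter (λ w → E G v w Bool.≟ true) (allFin n) h)
                           (∑-cong (allFin n) λ w → cong (if_then h w else 0ℚ) (does-≟-true (E G v w)))
    where
    does-≟-true : ∀ b → does (b Bool.≟ true) ≡ b
    does-≟-true true  = refl
    does-≟-true false = refl

  ∑-neighbours-≤-term : ∀ {v w} {h : Fin n → ℚ} → (∀ x → h x ≤ℚ 0ℚ) → E G v w ≡ true →
                        ∑ (neighbours G v) h ≤ℚ h w
  ∑-neighbours-≤-term {v} {w} {h} h≤0 Evw = begin
    ∑ (neighbours G v) h                                 ≡⟨ ∑-neighbours v h ⟩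
    ∑[ x ∈ allFin n ] (if E G v x then h x else 0ℚ)      ≤⟨ ∑-nonPos-≤-term restricted≤0 w ⟩
    (if E G v w then h w else 0ℚ)                        ≡⟨ cong (if_then h w else 0ℚ) Evw ⟩
    h w                                                  ∎
    where
    open ℚ.≤-Reasoning
    restricted≤0 : ∀ x → (if E G v x then h x else 0ℚ) ≤ℚ 0ℚ
    restricted≤0 x with E G v x
    ... | true  = h≤0 x
    ... | false = ℚ.≤-refl

  module _ {g h : Fin n → Fin n → ℚ} where

    ∑ᴱ-cong : (∀ v w → g v w ≡ h v w) → ∑ᴱ g ≡ ∑ᴱ h
    ∑ᴱ-cong g≡h = ∑-cong (allFin n) λ v → ∑-cong (neighbours G v) (g≡h v)

    ∑ᴱ-mono-≤ : (∀ v w → g v w ≤ℚ h v w) → ∑ᴱ g ≤ℚ ∑ᴱ h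
    ∑ᴱ-mono-≤ g≤h = ∑-mono-≤ (allFin n) λ v → ∑-mono-≤ (neighbours G v) (g≤h v)

    ∑ᴱ-distrib-+ : ∑ᴱ (λ v w → g v w + h v w) ≡ ∑ᴱ g + ∑ᴱ h
    ∑ᴱ-distrib-+ = trans (∑-cong (allFin n) λ v → ∑-distrib-+ (neighbours G v)) (∑-distrib-+ (allFin n))

  ∑ᴱ-*ˡ : ∀ c h → ∑ᴱ (λ v w → c * h v w) ≡ c * ∑ᴱ h
  ∑ᴱ-*ˡ c h = trans (∑-cong (allFin n) λ v → ∑-*ˡ (neighbours G v) c (h v)) (∑-*ˡ (allFin n) c _)

  ∑ᴱ-flip : ∀ h → ∑ᴱ h ≡ ∑ᴱ (flip h)
  ∑ᴱ-flip h = begin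
    ∑ᴱ h                                                                   ≡⟨ ∑-cong (allFin n) (λ v → ∑-neighbours v (h v)) ⟩
    ∑[ v ∈ allFin n ] ∑[ w ∈ allFin n ] (if E G v w then h v w else 0ℚ)    ≡⟨ ∑-comm (allFin n) (allFin n) _ ⟩
    ∑[ w ∈ allFin n ] ∑[ v ∈ allFin n ] (if E G v w then h v w else 0ℚ)    ≡⟨ ∑-cong (allFin n) (λ w → ∑-cong (allFin n) λ v →
                                                                                cong (if_then h v w else 0ℚ) (Graph.sym G v w)) ⟩
    ∑[ w ∈ allFin n ] ∑[ v ∈ allFin n ] (if E G w v then h v w else 0ℚ)    ≡⟨ ∑-cong (allFin n) (λ w → ∑-neighbours w (flip h w)) ⟨
    ∑ᴱ (flip h)                                                            ∎
    where open ≡-Reasoning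

  ∑ᴱ-nonPos-≤-edge : ∀ {h u w} → (∀ v w → h v w ≤ℚ 0ℚ) → E G u w ≡ true → ∑ᴱ h ≤ℚ h u w + h w u
  ∑ᴱ-nonPos-≤-edge {h} {u} {w} h≤0 Euw = begin
    ∑ᴱ h                  ≤⟨ ∑-nonPos-≤-two-terms rows≤0 (E⇒≢ Euw) ⟩
    row u + row w         ≤⟨ ℚ.+-mono-≤ (∑-neighbours-≤-term (h≤0 u) Euw) (∑-neighbours-≤-term (h≤0 w) Ewu) ⟩
    h u w + h w u         ∎
    where
    open ℚ.≤-Reasoning
    row : Fin n → ℚ
    row v = ∑ (neighbours G v) (h v)
    rows≤0 : ∀ v → row v ≤ℚ 0ℚ
    rows≤0 v = ℚ.≤-trans (∑-mono-≤ (neighbours G v) (h≤0 v)) (ℚ.≤-reflexive (∑-zero (neighbours G v)))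
    Ewu : E G w u ≡ true
    Ewu = trans (Graph.sym G w u) Euw

  ∑ᴱ≤-1 : ∀ {g u w} → (∀ v w → g v w + g w v ≤ℚ 0ℚ) → E G u w ≡ true → g u w + g w u ≤ℚ - 1ℚ →
          ∑ᴱ g ≤ℚ - 1ℚ
  ∑ᴱ≤-1 {g} {u} {w} pairs≤0 Euw edge≤-1 = p+p≤q+q⇒p≤q (begin
    ∑ᴱ g + ∑ᴱ g                               ≡⟨ cong (∑ᴱ g +_) (∑ᴱ-flip g) ⟩
    ∑ᴱ g + ∑ᴱ (flip g)                        ≡⟨ ∑ᴱ-distrib-+ ⟨
    ∑ᴱ (λ v w → g v w + g w v)                ≤⟨ ∑ᴱ-nonPos-≤-edge pairs≤0 Euw ⟩
    (g u w + g w u) + (g w u + g u w)         ≤⟨ ℚ.+-mono-≤ edge≤-1 (subst (_≤ℚ - 1ℚ) (ℚ.+-comm (g u w) (g w u)) edge≤-1) ⟩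
    - 1ℚ + - 1ℚ                               ∎)
    where open ℚ.≤-Reasoning

-- The Moran step

nextExpectation : Graph n → (Fin k → ℚ) → (State n k → ℚ) → State n k → ℚ
nextExpectation G f Φ S = ∑ᴱ G (λ v w → stepProb G f S v w * Φ (update S v w))

module _ (G : Graph n) (f : Fin k → ℚ) (S : State n k) where

  stepProb≡ : ∀ v w → stepProb G f S v w ≡ f (S v) * (1ℚ ÷₀ totalFitness f S) * invDeg G v
  stepProb≡ v w = cong (_* invDeg G v) (÷₀≡*1÷₀ (f (S v)) (totalFitness f S))

  module _ (f≥0 : ∀ i → 0ℚ ≤ℚ f i) where

    totalFitness-nonNeg : 0ℚ ≤ℚ totalFitness f S
    totalFitness-nonNeg = ∑-nonNeg (allFin n) (λ u → f≥0 (S u))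

    stepProb-nonNeg : ∀ v w → 0ℚ ≤ℚ stepProb G f S v w
    stepProb-nonNeg v w = subst (0ℚ ≤ℚ_) (sym (stepProb≡ v w))
      (*-nonNeg (*-nonNeg (f≥0 (S v)) (1÷₀-nonNeg totalFitness-nonNeg)) (invDeg-nonNeg G v))

    ∑ᴱ-stepProb≤1 : ∑ᴱ G (stepProb G f S) ≤ℚ 1ℚ
    ∑ᴱ-stepProb≤1 = begin
      ∑ᴱ G (stepProb G f S)                        ≤⟨ ∑-mono-≤ (allFin n) row≤ ⟩
      ∑[ v ∈ allFin n ] (r * f (S v))              ≡⟨ ∑-*ˡ (allFin n) r (λ v → f (S v)) ⟩
      r * totalFitness f S                         ≤⟨ 1÷₀-*-≤1 (totalFitness f S) ⟩
      1ℚ                                           ∎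
      where
      open ℚ.≤-Reasoning
      r : ℚ
      r = 1ℚ ÷₀ totalFitness f S
      row≤ : ∀ v → ∑ (neighbours G v) (stepProb G f S v) ≤ℚ r * f (S v)
      row≤ v = begin
        ∑ (neighbours G v) (stepProb G f S v)                 ≡⟨ ∑-const (neighbours G v) (stepProb G f S v v) ⟩
        ℕtoℚ (deg G v) * stepProb G f S v v                   ≡⟨ cong (ℕtoℚ (deg G v) *_) (stepProb≡ v v) ⟩
        ℕtoℚ (deg G v) * (f (S v) * r * invDeg G v)           ≡⟨ regroup (ℕtoℚ (deg G v)) (f (S v)) r (invDeg G v) ⟩
        (r * f (S v)) * (invDeg G v * ℕtoℚ (deg G v))         ≤⟨ *-monoˡ-≤ (*-nonNeg (1÷₀-nonNeg totalFitness-nonNeg) (f≥0 (S v)))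
                                                                   (1÷₀-*-≤1 (ℕtoℚ (deg G v))) ⟩
        (r * f (S v)) * 1ℚ                                    ≡⟨ ℚ.*-identityʳ _ ⟩
        r * f (S v)                                           ∎
        where
        regroup : ∀ d x y z → d * (x * y * z) ≡ (y * x) * (z * d)
        regroup = solve-∀ ℚ-ring

expTrunc≤Lyapunov : ∀ (G : Graph n) (f : Fin k → ℚ) j (Φ : State n k → ℚ) →
                    (∀ i → 0ℚ ≤ℚ f i) → (∀ S → 0ℚ ≤ℚ Φ S) →
                    (∀ S → stopped j S ≡ false → 1ℚ + nextExpectation G f Φ S ≤ℚ Φ S) →
                    ∀ T S → expTrunc G f j T S ≤ℚ Φ S
expTrunc≤Lyapunov G f j Φ f≥0 Φ≥0 drift zero    S = Φ≥0 S
expTrunc≤Lyapunov G f j Φ f≥0 Φ≥0 drift (suc T) S with stopped j S in unstopped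
... | true  = Φ≥0 S
... | false = ℚ.≤-trans (ℚ.+-monoʳ-≤ 1ℚ (∑ᴱ-mono-≤ G λ v w →
                *-monoˡ-≤ (stepProb-nonNeg G f S f≥0 v w) (expTrunc≤Lyapunov G f j Φ f≥0 Φ≥0 drift T (update S v w))))
              (drift S unstopped)

record BoundaryEdge (G : Graph n) (j : Fin k) (S : State n k) : Set where
  field
    u w     : Fin n
    edge    : E G u w ≡ true
    maximal : ∀ v → toℕ (S v) ≤ toℕ (S u)
    above   : toℕ j ≤ toℕ (S u)
    below   : toℕ (S w) < toℕ (S u)

-- Unstopped: some type is ≥ j and the maximal type m is not everywhere, so a walk from type m to a
-- smaller type leaves the vertices of type m along some edge.
unstopped⇒BoundaryEdge : ∀ {G : Graph n} {j : Fin k} {S} → Connected G → stopped j S ≡ false → BoundaryEdge G j S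
unstopped⇒BoundaryEdge {zero}  _ ()
unstopped⇒BoundaryEdge {suc n} {k} {G} {j} {S} connected unstopped =
  let u , w , Euw , m≤Su , m≰Sw = Reach⇒crossingEdge G (λ x → m ≤ᶠ S x) (connected top lower)
                                    (≤⇒≤ᶠ {i = m} {m} ℕ.≤-refl) (>⇒≤ᶠ≡false lower<m)
      Su≡m : toℕ (S u) ≡ toℕ m
      Su≡m = ℕ.≤-antisym (maximal u) (≤ᶠ⇒≤ m≤Su)
  in record
       { u       = u
       ; w       = w
       ; edge    = Euw
       ; maximal = λ v → subst (toℕ (S v) ≤_) (sym Su≡m) (maximal v)
       ; above   = subst (toℕ j ≤_) (sym Su≡m) j≤m
       ; below   = subst (toℕ (S w) <_) (sym Su≡m) (≤ᶠ≡false⇒> m≰Sw)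
       }
  where
  someAbove : ∃ λ v → not (j ≤ᶠ S v) ≡ false
  someAbove = all≡false⇒∃ _ (allFin _) (Bool.∨-conicalˡ _ _ unstopped)
  top : Fin (suc n)
  top = argmax (toℕ ∘ S) (proj₁ someAbove) (allFin _)
  m : Fin k
  m = S top
  maximal : ∀ v → toℕ (S v) ≤ toℕ m
  maximal v = All.lookup (f[xs]≤f[argmax] {f = toℕ ∘ S} (proj₁ someAbove) (allFin _)) (∈-allFin v)
  j≤m : toℕ j ≤ toℕ m
  j≤m = ℕ.≤-trans (≤ᶠ⇒≤ (trans (sym (Bool.not-involutive _)) (cong not (proj₂ someAbove)))) (maximal (proj₁ someAbove))
  notAllTop : all (λ v → S v =ᶠ m) (allFin _) ≡ false
  notAllTop = subst (λ b → b ∧ all (λ v → S v =ᶠ m) (allFin _) ≡ false) (≤⇒≤ᶠ j≤m)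
                (any≡false⇒ _ (Bool.∨-conicalʳ _ _ unstopped) (∈-allFin m))
  someBelow : ∃ λ v → (S v =ᶠ m) ≡ false
  someBelow = all≡false⇒∃ _ (allFin _) notAllTop
  lower : Fin (suc n)
  lower = proj₁ someBelow
  lower<m : toℕ (S lower) < toℕ m
  lower<m = ℕ.≤∧≢⇒< (maximal lower) (=ᶠ≡false⇒≢ (proj₂ someBelow) ∘ Fin.toℕ-injective)

-- Potentials

module _ (G : Graph n) (ψ : Fin k → ℚ) where

  potential : State n k → ℚ
  potential S = ∑[ u ∈ allFin n ] (invDeg G u * ψ (S u))

  potential-update : ∀ S v w → potential (update S v w) ≡ potential S + invDeg G w * (ψ (S v) - ψ (S w))
  potential-update S v w = begin
    potential (update S v w)                                          ≡⟨ ∑-cong (allFin n) pointwise ⟩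
    ∑[ u ∈ allFin n ] (invDeg G u * ψ (S u) + δ u)                    ≡⟨ ∑-distrib-+ (allFin n) ⟩
    potential S + ∑ (allFin n) δ                                      ≡⟨ cong (potential S +_) (∑-allFin-δ n w _) ⟩
    potential S + invDeg G w * (ψ (S v) - ψ (S w))                    ∎
    where
    open ≡-Reasoning
    δ : Fin n → ℚ
    δ u = if u =ᶠ w then invDeg G w * (ψ (S v) - ψ (S w)) else 0ℚ
    split : ∀ i p q → i * p ≡ i * q + i * (p - q)
    split = solve-∀ ℚ-ring
    pointwise : ∀ u → invDeg G u * ψ (update S v w u) ≡ invDeg G u * ψ (S u) + δ u
    pointwise u with u Fin.≟ w
    ... | yes refl = split (invDeg G u) (ψ (S v)) (ψ (S u))
    ... | no  _    = sym (ℚ.+-identityʳ _)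

  module _ (f : Fin k → ℚ) (S : State n k) where

    driftTerm : Fin n → Fin n → ℚ
    driftTerm v w = stepProb G f S v w * (invDeg G w * (ψ (S v) - ψ (S w)))

    nextExpectation-potential : nextExpectation G f potential S ≡ potential S * ∑ᴱ G (stepProb G f S) + ∑ᴱ G driftTerm
    nextExpectation-potential = begin
      nextExpectation G f potential S                                        ≡⟨ ∑ᴱ-cong G pointwise ⟩
      ∑ᴱ G (λ v w → potential S * stepProb G f S v w + driftTerm v w)        ≡⟨ ∑ᴱ-distrib-+ G ⟩
      ∑ᴱ G (λ v w → potential S * stepProb G f S v w) + ∑ᴱ G driftTerm       ≡⟨ cong (_+ ∑ᴱ G driftTerm) (∑ᴱ-*ˡ G (potential S) _) ⟩
      potential S * ∑ᴱ G (stepProb G f S) + ∑ᴱ G driftTerm                   ∎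
      where
      open ≡-Reasoning
      expand : ∀ p Φ d → p * (Φ + d) ≡ Φ * p + p * d
      expand = solve-∀ ℚ-ring
      pointwise : ∀ v w → stepProb G f S v w * potential (update S v w) ≡ potential S * stepProb G f S v w + driftTerm v w
      pointwise v w = trans (cong (stepProb G f S v w *_) (potential-update S v w))
                            (expand (stepProb G f S v w) (potential S) _)

    driftTerm-pair : ∀ v w → driftTerm v w + driftTerm w v ≡
                     (1ℚ ÷₀ totalFitness f S) * (invDeg G v * invDeg G w) * ((f (S v) - f (S w)) * (ψ (S v) - ψ (S w)))
    driftTerm-pair v w =
      trans (cong₂ (λ p p′ → p * (invDeg G w * (ψ (S v) - ψ (S w))) + p′ * (invDeg G v * (ψ (S w) - ψ (S v))))
                   (stepProb≡ G f S v w) (stepProb≡ G f S w v))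
            (pair (f (S v)) (f (S w)) (1ℚ ÷₀ totalFitness f S) (invDeg G v) (invDeg G w) (ψ (S v)) (ψ (S w)))
      where
      pair : ∀ fv fw r iv iw ψv ψw → fv * r * iv * (iw * (ψv - ψw)) + fw * r * iw * (iv * (ψw - ψv)) ≡
                                     r * (iv * iw) * ((fv - fw) * (ψv - ψw))
      pair = solve-∀ ℚ-ring

    module _ (f≥0 : ∀ i → 0ℚ ≤ℚ f i) (ψ≥0 : ∀ t → 0ℚ ≤ℚ ψ t) where

      driftTerm-pair-nonPos : (∀ {x y} → toℕ x ≤ toℕ y → f x ≤ℚ f y) → (∀ {x y} → toℕ x ≤ toℕ y → ψ y ≤ℚ ψ x) →
                              ∀ v w → driftTerm v w + driftTerm w v ≤ℚ 0ℚ
      driftTerm-pair-nonPos f-mono ψ-anti v w = ℚ.≤-trans (ℚ.≤-reflexive (driftTerm-pair v w))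
        (*-nonNeg-nonPos (*-nonNeg (1÷₀-nonNeg (totalFitness-nonNeg G f S f≥0)) (*-nonNeg (invDeg-nonNeg G v) (invDeg-nonNeg G w)))
                         (cross (S v) (S w)))
        where
        cross : ∀ x y → (f x - f y) * (ψ x - ψ y) ≤ℚ 0ℚ
        cross x y with ℕ.≤-total (toℕ x) (toℕ y)
        ... | inj₁ x≤y = *-nonPos-nonNeg (p≤q⇒p-q≤0 (f-mono x≤y)) (p≤q⇒0≤q-p (ψ-anti x≤y))
        ... | inj₂ y≤x = *-nonNeg-nonPos (p≤q⇒0≤q-p (f-mono y≤x)) (p≤q⇒p-q≤0 (ψ-anti y≤x))

      potential-nonNeg : 0ℚ ≤ℚ potential S
      potential-nonNeg = ∑-nonNeg (allFin n) λ u → *-nonNeg (invDeg-nonNeg G u) (ψ≥0 (S u))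

      potential-drift : ∑ᴱ G driftTerm ≤ℚ - 1ℚ → 1ℚ + nextExpectation G f potential S ≤ℚ potential S
      potential-drift drift≤-1 = begin
        1ℚ + nextExpectation G f potential S                          ≡⟨ cong (1ℚ +_) nextExpectation-potential ⟩
        1ℚ + (potential S * ∑ᴱ G (stepProb G f S) + ∑ᴱ G driftTerm)   ≤⟨ ℚ.+-monoʳ-≤ 1ℚ (ℚ.+-mono-≤ (*-monoˡ-≤ potential-nonNeg
                                                                            (∑ᴱ-stepProb≤1 G f S f≥0)) drift≤-1) ⟩
        1ℚ + (potential S * 1ℚ + - 1ℚ)                                ≡⟨ cancel (potential S) ⟩
        potential S                                                   ∎
        where
        open ℚ.≤-Reasoning
        cancel : ∀ x → 1ℚ + (x * 1ℚ + - 1ℚ) ≡ x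
        cancel = solve-∀ ℚ-ring

module _ (j : Fin k) (c : Fin k → ℚ) (c≥0 : ∀ i → 0ℚ ≤ℚ c i) where

  private
    term : Fin k → Fin k → ℚ
    term t i = if j ≤ᶠ i then (if i ≤ᶠ t then 0ℚ else c i) else 0ℚ

    term-nonNeg : ∀ t i → 0ℚ ≤ℚ term t i
    term-nonNeg t i with j ≤ᶠ i | i ≤ᶠ t
    ... | false | _     = ℚ.≤-refl
    ... | true  | true  = ℚ.≤-refl
    ... | true  | false = c≥0 i

    term-antitone : ∀ {x y} → toℕ x ≤ toℕ y → ∀ i → term y i ≤ℚ term x i
    term-antitone {x} {y} x≤y i with j ≤ᶠ i | i ≤ᶠ y in i≤ᶠy | i ≤ᶠ x in i≤ᶠx
    ... | false | _     | _     = ℚ.≤-refl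
    ... | true  | true  | true  = ℚ.≤-refl
    ... | true  | true  | false = c≥0 i
    ... | true  | false | false = ℚ.≤-refl
    ... | true  | false | true  =
      ⊥-elim (ℕ.<⇒≱ (≤ᶠ≡false⇒> {i = i} {y} i≤ᶠy) (ℕ.≤-trans (≤ᶠ⇒≤ {i = i} {x} i≤ᶠx) x≤y))

  tailWeight : Fin k → ℚ
  tailWeight t = ∑ (allFin k) (term t)

  tailWeight-nonNeg : ∀ t → 0ℚ ≤ℚ tailWeight t
  tailWeight-nonNeg t = ∑-nonNeg (allFin k) (term-nonNeg t)

  tailWeight≤ : ∀ t → tailWeight t ≤ℚ ∑[ i ∈ allFin k ] (if j ≤ᶠ i then c i else 0ℚ)
  tailWeight≤ t = ∑-mono-≤ (allFin k) term≤
    where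
    term≤ : ∀ i → term t i ≤ℚ (if j ≤ᶠ i then c i else 0ℚ)
    term≤ i with j ≤ᶠ i | i ≤ᶠ t
    ... | false | _     = ℚ.≤-refl
    ... | true  | true  = c≥0 i
    ... | true  | false = ℚ.≤-refl

  tailWeight-antitone : ∀ {x y} → toℕ x ≤ toℕ y → tailWeight y ≤ℚ tailWeight x
  tailWeight-antitone x≤y = ∑-mono-≤ (allFin k) (term-antitone x≤y)

  tailWeight-gap : ∀ {b m} → toℕ b < toℕ m → toℕ j ≤ toℕ m → c m ≤ℚ tailWeight b - tailWeight m
  tailWeight-gap {b} {m} b<m j≤m = begin
    c m                                                 ≡⟨ ∑-allFin-δ k m (c m) ⟨
    ∑[ i ∈ allFin k ] (if i =ᶠ m then c m else 0ℚ)      ≤⟨ ∑-mono-≤ (allFin k) δ≤ ⟩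
    ∑[ i ∈ allFin k ] (term b i - term m i)             ≡⟨ ∑-distrib-+ (allFin k) ⟩
    tailWeight b + ∑[ i ∈ allFin k ] (- term m i)       ≡⟨ cong (tailWeight b +_) (∑-neg (allFin k) (term m)) ⟩
    tailWeight b - tailWeight m                         ∎
    where
    open ℚ.≤-Reasoning
    δ≤ : ∀ i → (if i =ᶠ m then c m else 0ℚ) ≤ℚ term b i - term m i
    δ≤ i with i Fin.≟ m
    ... | no  _    = p≤q⇒0≤q-p (term-antitone (ℕ.<⇒≤ b<m) i)
    ... | yes refl rewrite ≤⇒≤ᶠ j≤m | >⇒≤ᶠ≡false b<m | ≤⇒≤ᶠ (ℕ.≤-refl {toℕ i}) =
      ℚ.≤-reflexive (sym (ℚ.+-identityʳ (c i)))

module _ (G : Graph n) (connected : Connected G) (f : Fin k → ℚ) (f≥1 : ∀ i → 1ℚ ≤ℚ f i)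
         (f-strict : ∀ i i′ → toℕ i < toℕ i′ → f i <ℚ f i′) (j : Fin k) (j≥1 : 1 ≤ toℕ j) where

  private
    f≥0 : ∀ i → 0ℚ ≤ℚ f i
    f≥0 i = ℚ.≤-trans 0≤1 (f≥1 i)

    f-mono : ∀ {x y} → toℕ x ≤ toℕ y → f x ≤ℚ f y
    f-mono {x} {y} x≤y with ℕ.m≤n⇒m<n∨m≡n x≤y
    ... | inj₁ x<y = ℚ.<⇒≤ (f-strict x y x<y)
    ... | inj₂ x≡y = ℚ.≤-reflexive (cong f (Fin.toℕ-injective x≡y))

    gap : Fin k → ℚ
    gap i = f i - f (prevT i)

    gap-nonNeg : ∀ i → 0ℚ ≤ℚ gap i
    gap-nonNeg i = p≤q⇒0≤q-p (f-mono (subst (_≤ toℕ i) (sym (toℕ-prevT i)) ℕ.pred[n]≤n))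

    gap≢0 : ∀ {i} → 1 ≤ toℕ i → gap i ≢ 0ℚ
    gap≢0 {i} i≥1 = ℚ.<⇒≢ (p<q⇒0<q-p (f-strict (prevT i) i prev<i)) ∘ sym
      where
      prev<i : toℕ (prevT i) < toℕ i
      prev<i = subst (_< toℕ i) (sym (toℕ-prevT i)) (ℕ.≤-reflexive (ℕ.suc-pred (toℕ i) {{ℕ.>-nonZero i≥1}}))

    n³ : ℚ
    n³ = ℕtoℚ (n ℕ.* n ℕ.* n)

    -- Chosen so that gap i * c i = f i * n³: a boundary edge below top type i then has drift ≤ -1.
    c : Fin k → ℚ
    c i = (f i ÷₀ gap i) * n³

    c-nonNeg : ∀ i → 0ℚ ≤ℚ c i
    c-nonNeg i = *-nonNeg (÷₀-nonNeg (f≥0 i) (gap-nonNeg i)) (ℕtoℚ-nonNeg (n ℕ.* n ℕ.* n))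

    gap*c≡f*n³ : ∀ {i} → 1 ≤ toℕ i → gap i * c i ≡ f i * n³
    gap*c≡f*n³ {i} i≥1 = begin
      gap i * ((f i ÷₀ gap i) * n³)               ≡⟨ cong (λ x → gap i * (x * n³)) (÷₀≡*1÷₀ (f i) (gap i)) ⟩
      gap i * (f i * (1ℚ ÷₀ gap i) * n³)          ≡⟨ regroup (gap i) (f i) (1ℚ ÷₀ gap i) n³ ⟩
      (1ℚ ÷₀ gap i) * gap i * (f i * n³)          ≡⟨ cong (_* (f i * n³)) (1÷₀-inverse (gap≢0 i≥1)) ⟩
      1ℚ * (f i * n³)                             ≡⟨ ℚ.*-identityˡ (f i * n³) ⟩
      f i * n³                                    ∎
      where
      open ≡-Reasoning
      regroup : ∀ g x y z → g * (x * y * z) ≡ y * g * (x * z)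
      regroup = solve-∀ ℚ-ring

    ψ : Fin k → ℚ
    ψ = tailWeight j c c-nonNeg

    Φ : State n k → ℚ
    Φ = potential G ψ

  Φ≤bound : ∀ S → Φ S ≤ℚ bound n f j
  Φ≤bound S = begin
    Φ S                                                          ≤⟨ ∑-mono-≤ (allFin n) vertex≤ ⟩
    ∑[ u ∈ allFin n ] top                                        ≡⟨ ∑-allFin-const n top ⟩
    ℕtoℚ n * top                                                 ≡⟨ ∑-*ˡ (allFin k) (ℕtoℚ n) _ ⟨
    ∑[ i ∈ allFin k ] (ℕtoℚ n * (if j ≤ᶠ i then c i else 0ℚ))    ≤⟨ ∑-mono-≤ (allFin k) type≤ ⟩
    bound n f j                                                  ∎
    where
    open ℚ.≤-Reasoning
    top : ℚ
    top = ∑[ i ∈ allFin k ] (if j ≤ᶠ i then c i else 0ℚ)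
    vertex≤ : ∀ u → invDeg G u * ψ (S u) ≤ℚ top
    vertex≤ u = ℚ.≤-trans (*-monoʳ-≤ (tailWeight-nonNeg j c c-nonNeg (S u)) (invDeg≤1 G u))
                          (ℚ.≤-trans (ℚ.≤-reflexive (ℚ.*-identityˡ _)) (tailWeight≤ j c c-nonNeg (S u)))
    type≤ : ∀ i → ℕtoℚ n * (if j ≤ᶠ i then c i else 0ℚ) ≤ℚ
                  (if j ≤ᶠ i then (f i ÷₀ gap i) * ℕtoℚ (suc n ℕ.* (n ℕ.* n ℕ.* n)) else 0ℚ)
    type≤ i with j ≤ᶠ i
    ... | false = ℚ.≤-reflexive (ℚ.*-zeroʳ (ℕtoℚ n))
    ... | true  = begin
      ℕtoℚ n * ((f i ÷₀ gap i) * n³)                          ≡⟨ swap (ℕtoℚ n) (f i ÷₀ gap i) n³ ⟩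
      (f i ÷₀ gap i) * (ℕtoℚ n * n³)                          ≡⟨ cong ((f i ÷₀ gap i) *_) (ℕtoℚ-homo-* n (n ℕ.* n ℕ.* n)) ⟨
      (f i ÷₀ gap i) * ℕtoℚ (n ℕ.* (n ℕ.* n ℕ.* n))          ≤⟨ *-monoˡ-≤ (÷₀-nonNeg (f≥0 i) (gap-nonNeg i))
                                                                   (ℕtoℚ-mono-≤ (ℕ.*-monoˡ-≤ (n ℕ.* n ℕ.* n) (ℕ.n≤1+n n))) ⟩
      (f i ÷₀ gap i) * ℕtoℚ (suc n ℕ.* (n ℕ.* n ℕ.* n))      ∎
      where
      swap : ∀ x y z → x * (y * z) ≡ y * (x * z)
      swap = solve-∀ ℚ-ring

  module _ {S : State n k} (boundary : BoundaryEdge G j S) where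

    open BoundaryEdge boundary

    private
      N : ℚ
      N = ℕtoℚ n

      m : Fin k
      m = S u

      K : ℚ
      K = (1ℚ ÷₀ totalFitness f S) * (invDeg G u * invDeg G w)

      Δf Δψ : ℚ
      Δf = f m - f (S w)
      Δψ = ψ (S w) - ψ m

    totalFitness≤N*f : totalFitness f S ≤ℚ N * f m
    totalFitness≤N*f = begin
      totalFitness f S                  ≤⟨ ∑-mono-≤ (allFin n) (λ v → f-mono (maximal v)) ⟩
      ∑[ v ∈ allFin n ] f m             ≡⟨ ∑-allFin-const n (f m) ⟩
      N * f m                           ∎
      where open ℚ.≤-Reasoning

    totalFitness≢0 : totalFitness f S ≢ 0ℚ
    totalFitness≢0 W≡0 = ℚ.<⇒≢ (ℚ.<-≤-trans (ℚ.positive⁻¹ 1ℚ) 1≤W) (sym W≡0)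
      where
      1≤W : 1ℚ ≤ℚ totalFitness f S
      1≤W = ℚ.≤-trans (f≥1 m) (∑-nonNeg-≥-term (λ v → f≥0 (S v)) u)

    1≤K*f*n³ : 1ℚ ≤ℚ K * (f m * n³)
    1≤K*f*n³ = begin
      1ℚ                                                               ≡⟨ 1÷₀-inverse totalFitness≢0 ⟨
      r * totalFitness f S                                             ≤⟨ *-monoˡ-≤ r≥0 totalFitness≤N*f ⟩
      r * (N * f m)                                                    ≤⟨ *-monoˡ-≤ r≥0 N*f≤ ⟩
      r * ((N * invDeg G u) * (N * invDeg G w) * (N * f m))            ≡⟨ regroup r (invDeg G u) (invDeg G w) (f m) N ⟩
      K * (f m * (N * N * N))                                          ≡⟨ cong (λ x → K * (f m * x)) n³≡ ⟨
      K * (f m * n³)                                                   ∎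
      where
      open ℚ.≤-Reasoning
      r : ℚ
      r = 1ℚ ÷₀ totalFitness f S
      r≥0 : 0ℚ ≤ℚ r
      r≥0 = 1÷₀-nonNeg (totalFitness-nonNeg G f S f≥0)
      N*f≤ : N * f m ≤ℚ (N * invDeg G u) * (N * invDeg G w) * (N * f m)
      N*f≤ = ℚ.≤-trans (ℚ.≤-reflexive (sym (ℚ.*-identityˡ (N * f m))))
               (*-monoʳ-≤ (*-nonNeg (ℕtoℚ-nonNeg n) (f≥0 m))
                 (1≤p⇒1≤q⇒1≤p*q (1≤n*invDeg G (E⇒deg>0 G edge)) (1≤n*invDeg G (E⇒deg>0 G (trans (Graph.sym G w u) edge)))))
      n³≡ : n³ ≡ N * N * N
      n³≡ = trans (ℕtoℚ-homo-* (n ℕ.* n) n) (cong (_* N) (ℕtoℚ-homo-* n n))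
      regroup : ∀ r iu iw fm N → r * ((N * iu) * (N * iw) * (N * fm)) ≡ r * (iu * iw) * (fm * (N * N * N))
      regroup = solve-∀ ℚ-ring

    f*n³≤Δf*Δψ : f m * n³ ≤ℚ Δf * Δψ
    f*n³≤Δf*Δψ = begin
      f m * n³         ≡⟨ gap*c≡f*n³ (ℕ.≤-trans j≥1 above) ⟨
      gap m * c m      ≤⟨ *-mono-≤-nonNeg (gap-nonNeg m) (c-nonNeg m) gap≤Δf (tailWeight-gap j c c-nonNeg below above) ⟩
      Δf * Δψ          ∎
      where
      open ℚ.≤-Reasoning
      Sw≤prev : toℕ (S w) ≤ toℕ (prevT m)
      Sw≤prev = subst (toℕ (S w) ≤_) (sym (toℕ-prevT m)) (ℕ.<⇒≤pred below)
      gap≤Δf : gap m ≤ℚ Δf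
      gap≤Δf = ℚ.+-monoʳ-≤ (f m) (ℚ.neg-antimono-≤ (f-mono Sw≤prev))

    boundary-drift≤-1 : driftTerm G ψ f S u w + driftTerm G ψ f S w u ≤ℚ - 1ℚ
    boundary-drift≤-1 = begin
      driftTerm G ψ f S u w + driftTerm G ψ f S w u      ≡⟨ driftTerm-pair G ψ f S u w ⟩
      K * ((f m - f (S w)) * (ψ m - ψ (S w)))            ≡⟨ flipSign K (f m) (f (S w)) (ψ m) (ψ (S w)) ⟩
      - (K * (Δf * Δψ))                                  ≤⟨ ℚ.neg-antimono-≤ (ℚ.≤-trans 1≤K*f*n³ (*-monoˡ-≤ K≥0 f*n³≤Δf*Δψ)) ⟩
      - 1ℚ                                               ∎
      where
      open ℚ.≤-Reasoning
      K≥0 : 0ℚ ≤ℚ K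
      K≥0 = *-nonNeg (1÷₀-nonNeg (totalFitness-nonNeg G f S f≥0)) (*-nonNeg (invDeg-nonNeg G u) (invDeg-nonNeg G w))
      flipSign : ∀ K a b x y → K * ((a - b) * (x - y)) ≡ - (K * ((a - b) * (y - x)))
      flipSign = solve-∀ ℚ-ring

  potential-drift≤-1 : ∀ S → stopped j S ≡ false → 1ℚ + nextExpectation G f Φ S ≤ℚ Φ S
  potential-drift≤-1 S unstopped = potential-drift G ψ f S f≥0 (tailWeight-nonNeg j c c-nonNeg)
    (∑ᴱ≤-1 G (driftTerm-pair-nonPos G ψ f S f≥0 (tailWeight-nonNeg j c c-nonNeg) f-mono (tailWeight-antitone j c c-nonNeg))
             edge (boundary-drift≤-1 boundary))
    where
    boundary : BoundaryEdge G j S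
    boundary = unstopped⇒BoundaryEdge connected unstopped
    open BoundaryEdge boundary

  expTrunc≤bound : ∀ T S → expTrunc G f j T S ≤ℚ bound n f j
  expTrunc≤bound T S = ℚ.≤-trans
    (expTrunc≤Lyapunov G f j Φ f≥0 (λ S → potential-nonNeg G ψ f S f≥0 (tailWeight-nonNeg j c c-nonNeg)) potential-drift≤-1 T S)
    (Φ≤bound S)

lemma17 : (n k : ℕ) → 0 < k → (G : Graph n) → Connected G →
          (f : Fin k → ℚ) → (∀ i → 1ℚ ≤ℚ f i) →
          (∀ i i' → toℕ i < toℕ i' → f i <ℚ f i') →
          (M₀ : State n k) → Ω₀ n k M₀ →
          (j : Fin k) → 1 ≤ toℕ j →
          ∀ (T : ℕ) → expTrunc G f j T M₀ ≤ℚ bound n f j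
lemma17 n k _ G connected f f≥1 f-strict M₀ _ j j≥1 T = expTrunc≤bound G connected f f≥1 f-strict j j≥1 T M₀
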